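{- For any algorithm in the $\mathcal{GOSSIP}$ model that solves the NeighborExchange problem, and every $n$, there is a graph $G$ on $n$ nodes on which this algorithm takes at least $\Omega\!\left(\frac{\log n}{\log\log n}\right)$ rounds.
   Context: $\mathcal{GOSSIP}$ model: synchronous rounds on an undirected graph; each node may initiate a bidirectional communication with at most one neighbor per round, and the endpoints of each initiated communication exchange unbounded-size messages. NeighborExchange problem: each node has an initial message and every node must obtain the initial messages of all its neighbors. -}

module Defs where

open import Data.Nat using (ℕ; zero; suc)
open import Data.Fin using (Fin)
open import Data.Maybe using (Maybe; just)
open import Data.Sum using (_⊎_)
open import Relation.Binary.PropositionalEquality using (_≡_)
open import Relation.Nullary using (¬_)

record Graph (n : ℕ) : Set₁ where
  field
    Adj     : Fin n → Fin n → Set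
    sym     : ∀ {u v} → Adj u v → Adj v u
    irrefl  : ∀ {u} → ¬ Adj u u
open Graph public

-- An execution of the GOSSIP model on G: in round i (i = 0,1,2,...), every
-- node v initiates a communication with at most one neighbour (call i v).
record Schedule {n : ℕ} (G : Graph n) : Set where
  field
    call  : ℕ → Fin n → Maybe (Fin n)
    valid : ∀ i v w → call i v ≡ just w → Adj G v w
open Schedule public

Talk : ∀ {n} {G : Graph n} → Schedule G → ℕ → Fin n → Fin n → Set
Talk σ i v w = (call σ i v ≡ just w) ⊎ (call σ i w ≡ just v)

-- Knows σ t v u : after the first t rounds, node v holds the initial
-- message of node u (messages are unbounded, so nodes forward everything).
data Knows {n} {G : Graph n} (σ : Schedule G) : ℕ → Fin n → Fin n → Set where
  self : ∀ {t v} → Knows σ t v v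
  keep : ∀ {t v u} → Knows σ t v u → Knows σ (suc t) v u
  recv : ∀ {t v w u} → Talk σ t v w → Knows σ t w u → Knows σ (suc t) v u

SolvesNE : ∀ {n} {G : Graph n} → Schedule G → ℕ → Set
SolvesNE {n} {G} σ t = ∀ (v u : Fin n) → Adj G v u → Knows σ t v u

-- An algorithm: for every graph, its (arbitrary, even centralised) execution.
Algorithm : Set₁
Algorithm = ∀ (n : ℕ) (G : Graph n) → Schedule G

-- The graph is a Cayley graph of SL₂(ℤ/m) with respect to q matrices gᵢ = BⁱAB⁻ⁱ, where A = [[1,2],[0,1]]
-- and B = [[1,0],[2,1]] generate a free group. By ping-pong no nonempty reduced word in the gᵢ is the
-- identity over ℤ, and the entries of a word of length ≤ q stay below m, so such a word is not the identity
-- modulo m either: the graph has no cycle of length ≤ q. If NeighborExchange is solved in t < q rounds, the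
-- walk along which v learns the message of its neighbour u closes a cycle of length ≤ t + 1 with the edge uv
-- unless it is that edge, so u and v called each other directly. Each of the q·|SL₂| edges x — x gᵢ is thus
-- used, while a round contains at most |SL₂| calls initiated in SL₂; hence t ≥ q. Taking m = 2ᵏ with m⁴ ≤ n
-- makes q of order log n / log log n.
module Submission where

open import Data.Bool using (Bool; true; false; not)
open import Data.Fin using (Fin; zero; suc; toℕ; fromℕ<; inject≤; combine; remQuot; _≟_)
open import Data.List using (List; []; _∷_; length; last)
open import Data.List.Relation.Unary.Linked as Linked using (Linked; []; [-]; _∷_)
open import Data.Maybe using (just)
open import Data.Maybe.Properties using (just-injective)
open import Data.Nat as ℕ using (ℕ; zero; suc; z≤n; s≤s; NonZero)
import Data.Nat.Properties as ℕ
open import Data.Product using (Σ; ∃; _×_; _,_; proj₁; proj₂; uncurry)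
open import Data.Sum using (_⊎_; inj₁; inj₂; swap)
open import Function using (_∘_; _∘′_; case_of_)
open import Level using (0ℓ)
open import Relation.Nullary using (¬_; yes; no; contradiction)
open import Relation.Unary using (Pred; Decidable)
open import Relation.Binary.PropositionalEquality

open import Defs using (Graph; Schedule; valid; Talk; Knows; self; keep; recv; SolvesNE; Algorithm)

module Matrices where
  open import Data.Integer using (ℤ; _+_; _*_; -_; _-_; 0ℤ; 1ℤ)
  open import Data.Integer.Tactic.RingSolver using (solve-∀)

  record Mat : Set where
    constructor mat
    field a b c d : ℤ

  infixl 7 _⊗_
  _⊗_ : Mat → Mat → Mat
  mat a b c d ⊗ mat a′ b′ c′ d′ =
    mat (a * a′ + b * c′) (a * b′ + b * d′) (c * a′ + d * c′) (c * b′ + d * d′)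

  𝕀 : Mat
  𝕀 = mat 1ℤ 0ℤ 0ℤ 1ℤ

  det : Mat → ℤ
  det (mat a b c d) = a * d - b * c

  mat-cong : ∀ {a b c d a′ b′ c′ d′} → a ≡ a′ → b ≡ b′ → c ≡ c′ → d ≡ d′ →
             mat a b c d ≡ mat a′ b′ c′ d′
  mat-cong refl refl refl refl = refl

  ⊗-assoc : ∀ L M N → (L ⊗ M) ⊗ N ≡ L ⊗ (M ⊗ N)
  ⊗-assoc (mat a b c d) (mat e f g h) (mat i j k l) =
    mat-cong (row a b e f g h i k) (row a b e f g h j l) (row c d e f g h i k) (row c d e f g h j l)
    where
    row : ∀ a b e f g h i k → (a * e + b * g) * i + (a * f + b * h) * k ≡ a * (e * i + f * k) + b * (g * i + h * k)
    row = solve-∀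

  ⊗-identityˡ : ∀ M → 𝕀 ⊗ M ≡ M
  ⊗-identityˡ (mat a b c d) = mat-cong (top a c) (top b d) (bottom a c) (bottom b d)
    where
    top : ∀ x y → 1ℤ * x + 0ℤ * y ≡ x
    top = solve-∀
    bottom : ∀ x y → 0ℤ * x + 1ℤ * y ≡ y
    bottom = solve-∀

  ⊗-identityʳ : ∀ M → M ⊗ 𝕀 ≡ M
  ⊗-identityʳ (mat a b c d) = mat-cong (left a b) (right a b) (left c d) (right c d)
    where
    left : ∀ x y → x * 1ℤ + y * 0ℤ ≡ x
    left = solve-∀
    right : ∀ x y → x * 0ℤ + y * 1ℤ ≡ y
    right = solve-∀

  det-⊗ : ∀ M N → det (M ⊗ N) ≡ det M * det N
  det-⊗ (mat a b c d) (mat x y z w) = cauchyBinet a b c d x y z w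
    where
    cauchyBinet : ∀ a b c d x y z w →
      (a * x + b * z) * (c * y + d * w) - (a * y + b * w) * (c * x + d * z) ≡ (a * d - b * c) * (x * w - y * z)
    cauchyBinet = solve-∀

  adjugate : Mat → Mat
  adjugate (mat a b c d) = mat d (- b) (- c) a

  infixr 8 _•_
  _•_ : ℤ → Mat → Mat
  s • mat a b c d = mat (s * a) (s * b) (s * c) (s * d)

  adjugate-⊗ : ∀ M X → adjugate M ⊗ (M ⊗ X) ≡ det M • X
  adjugate-⊗ (mat a b c d) (mat x y z w) =
    mat-cong (top a b c d x z) (top a b c d y w) (bottom a b c d x z) (bottom a b c d y w)
    where
    top : ∀ a b c d x z → d * (a * x + b * z) + (- b) * (c * x + d * z) ≡ (a * d - b * c) * x
    top = solve-∀
    bottom : ∀ a b c d x z → (- c) * (a * x + b * z) + a * (c * x + d * z) ≡ (a * d - b * c) * z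
    bottom = solve-∀

  record ℤ² : Set where
    constructor vec
    field x y : ℤ

  infixr 6 _·_
  _·_ : Mat → ℤ² → ℤ²
  mat a b c d · vec x y = vec (a * x + b * y) (c * x + d * y)

  vec-cong : ∀ {x y x′ y′} → x ≡ x′ → y ≡ y′ → vec x y ≡ vec x′ y′
  vec-cong refl refl = refl

  ·-⊗ : ∀ M N v → (M ⊗ N) · v ≡ M · N · v
  ·-⊗ (mat a b c d) (mat a′ b′ c′ d′) (vec x y) = vec-cong (row a b a′ b′ c′ d′ x y) (row c d a′ b′ c′ d′ x y)
    where
    row : ∀ a b a′ b′ c′ d′ x y →
          (a * a′ + b * c′) * x + (a * b′ + b * d′) * y ≡ a * (a′ * x + b′ * y) + b * (c′ * x + d′ * y)
    row = solve-∀

  𝕀-· : ∀ v → 𝕀 · v ≡ v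
  𝕀-· (vec x y) = vec-cong (top x y) (bottom x y)
    where
    top : ∀ x y → 1ℤ * x + 0ℤ * y ≡ x
    top = solve-∀
    bottom : ∀ x y → 0ℤ * x + 1ℤ * y ≡ y
    bottom = solve-∀

module PingPong where
  open import Data.Integer using (ℤ; +_; -[1+_]; _+_; _*_; -_; _-_; ∣_∣; 0ℤ; 1ℤ)
  import Data.Integer.Properties as ℤ
  open import Data.Integer.Tactic.RingSolver using (solve-∀)
  open import Data.Fin.Properties using (toℕ-injective)

  open Matrices

  A B : ℤ → ℤ² → ℤ²
  A e (vec x y) = vec (x + (+ 2 * e) * y) y
  B f (vec x y) = vec x (y + (+ 2 * f) * x)

  A-+ : ∀ e e′ v → A e (A e′ v) ≡ A (e + e′) v
  A-+ e e′ (vec x y) = vec-cong (merge e e′ y x) refl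
    where
    merge : ∀ e e′ y x → x + (+ 2 * e′) * y + (+ 2 * e) * y ≡ x + (+ 2 * (e + e′)) * y
    merge = solve-∀

  B-+ : ∀ f f′ v → B f (B f′ v) ≡ B (f + f′) v
  B-+ f f′ (vec x y) = vec-cong refl (merge f f′ x y)
    where
    merge : ∀ f f′ x y → y + (+ 2 * f′) * x + (+ 2 * f) * x ≡ y + (+ 2 * (f + f′)) * x
    merge = solve-∀

  B-inverse : ∀ f v → B (- f) (B f v) ≡ v
  B-inverse f (vec x y) = vec-cong refl (cancel f x y)
    where
    cancel : ∀ f x y → y + (+ 2 * f) * x + (+ 2 * (- f)) * x ≡ y
    cancel = solve-∀

  Flat Steep : ℤ² → Set
  Flat  (vec x y) = ∣ y ∣ ℕ.< ∣ x ∣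
  Steep (vec x y) = ∣ x ∣ ℕ.< ∣ y ∣

  Flat[_] Steep[_] : ℤ → ℤ² → Set
  Flat[ i ]  = Flat  ∘ B (- i)
  Steep[ i ] = Steep ∘ B (- i)

  ∣x∣<∣y+2fx∣ : ∀ f x y → f ≢ 0ℤ → ∣ y ∣ ℕ.< ∣ x ∣ → ∣ x ∣ ℕ.< ∣ y + (+ 2 * f) * x ∣
  ∣x∣<∣y+2fx∣ f x y f≢0 ∣y∣<∣x∣ = ℕ.+-cancelʳ-< (∣ x ∣) (∣ x ∣) (∣ z ∣) (begin-strict
    ∣ x ∣ ℕ.+ ∣ x ∣            ≡⟨ cong (∣ x ∣ ℕ.+_) (ℕ.+-identityʳ ∣ x ∣) ⟨
    2 ℕ.* ∣ x ∣                ≡⟨ cong (2 ℕ.*_) (ℕ.*-identityˡ ∣ x ∣) ⟨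
    2 ℕ.* (1 ℕ.* ∣ x ∣)        ≤⟨ ℕ.*-monoʳ-≤ 2 (ℕ.*-monoˡ-≤ ∣ x ∣ 1≤∣f∣) ⟩
    2 ℕ.* (∣ f ∣ ℕ.* ∣ x ∣)    ≡⟨ ∣2fx∣ ⟨
    ∣ z - y ∣                  ≤⟨ ℤ.∣i-j∣≤∣i∣+∣j∣ z y ⟩
    ∣ z ∣ ℕ.+ ∣ y ∣            <⟨ ℕ.+-monoʳ-< ∣ z ∣ ∣y∣<∣x∣ ⟩
    ∣ z ∣ ℕ.+ ∣ x ∣            ∎)
    where
    open ℕ.≤-Reasoning
    z = y + (+ 2 * f) * x
    1≤∣f∣ : 1 ℕ.≤ ∣ f ∣
    1≤∣f∣ = ℕ.n≢0⇒n>0 (f≢0 ∘ ℤ.∣i∣≡0⇒i≡0)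
    ∣2fx∣ : ∣ z - y ∣ ≡ 2 ℕ.* (∣ f ∣ ℕ.* ∣ x ∣)
    ∣2fx∣ = begin-equality
      ∣ z - y ∣                  ≡⟨ cong ∣_∣ (shift y f x) ⟩
      ∣ + 2 * (f * x) ∣          ≡⟨ ℤ.abs-* (+ 2) (f * x) ⟩
      2 ℕ.* ∣ f * x ∣            ≡⟨ cong (2 ℕ.*_) (ℤ.abs-* f x) ⟩
      2 ℕ.* (∣ f ∣ ℕ.* ∣ x ∣)    ∎
      where
      shift : ∀ y f x → y + (+ 2 * f) * x - y ≡ + 2 * (f * x)
      shift = solve-∀

  B-Flat⇒Steep : ∀ f v → f ≢ 0ℤ → Flat v → Steep (B f v)
  B-Flat⇒Steep f (vec x y) f≢0 = ∣x∣<∣y+2fx∣ f x y f≢0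

  A-Steep⇒Flat : ∀ e v → e ≢ 0ℤ → Steep v → Flat (A e v)
  A-Steep⇒Flat e (vec x y) e≢0 = ∣x∣<∣y+2fx∣ e y x e≢0

  Flat-Steep-disjoint : ∀ v → Flat v → ¬ Steep v
  Flat-Steep-disjoint (vec x y) = ℕ.<-asym

  conjugate : ℤ → ℤ → ℤ² → ℤ²
  conjugate i e = B i ∘ A e ∘ B (- i)

  conjugate-+ : ∀ i e e′ v → conjugate i e (conjugate i e′ v) ≡ conjugate i (e + e′) v
  conjugate-+ i e e′ v = cong (B i) (trans (cong (A e) (B-inverse i (A e′ (B (- i) v)))) (A-+ e e′ (B (- i) v)))

  Flat[i]⇒Steep[j] : ∀ i j v → i ≢ j → Flat[ i ] v → Steep[ j ] v
  Flat[i]⇒Steep[j] i j v i≢j flat = subst Steep moved (B-Flat⇒Steep (i - j) (B (- i) v) i-j≢0 flat)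
    where
    i-j≢0 : i - j ≢ 0ℤ
    i-j≢0 = i≢j ∘ ℤ.i-j≡0⇒i≡j i j
    moved : B (i - j) (B (- i) v) ≡ B (- j) v
    moved = trans (B-+ (i - j) (- i) v) (cong (λ f → B f v) (telescope i j))
      where
      telescope : ∀ i j → i - j + (- i) ≡ - j
      telescope = solve-∀

  conjugate-Steep⇒Flat : ∀ i e v → e ≢ 0ℤ → Steep[ i ] v → Flat[ i ] (conjugate i e v)
  conjugate-Steep⇒Flat i e v e≢0 steep =
    subst Flat (sym (B-inverse i (A e (B (- i) v)))) (A-Steep⇒Flat e (B (- i) v) e≢0 steep)

  -- gᵢᵉ = (BⁱAB⁻ⁱ)ᵉ for the matrices A = [[1,2],[0,1]] and B = [[1,0],[2,1]], which act on ℤ² as A 1 and B 1.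
  -- Opaque, so that unification never unfolds its entries.
  opaque
    generator : ℤ → ℤ → Mat
    generator i e = mat (1ℤ - (+ 4 * i) * e) (+ 2 * e) (- ((+ 8 * i) * i * e)) (1ℤ + (+ 4 * i) * e)

    generator-· : ∀ i e v → generator i e · v ≡ conjugate i e v
    generator-· i e (vec x y) = vec-cong (top i e x y) (bottom i e x y)
      where
      top : ∀ i e x y → (1ℤ - (+ 4 * i) * e) * x + (+ 2 * e) * y ≡ x + (+ 2 * e) * (y + (+ 2 * (- i)) * x)
      top = solve-∀
      bottom : ∀ i e x y → (- ((+ 8 * i) * i * e)) * x + (1ℤ + (+ 4 * i) * e) * y
                         ≡ y + (+ 2 * (- i)) * x + (+ 2 * i) * (x + (+ 2 * e) * (y + (+ 2 * (- i)) * x))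
      bottom = solve-∀

    det-generator : ∀ i e → det (generator i e) ≡ 1ℤ
    det-generator = expand
      where
      expand : ∀ i e → (1ℤ - (+ 4 * i) * e) * (1ℤ + (+ 4 * i) * e) - (+ 2 * e) * (- ((+ 8 * i) * i * e)) ≡ 1ℤ
      expand = solve-∀

    generator-inverse : ∀ i e → generator i e ⊗ generator i (- e) ≡ 𝕀
    generator-inverse i e = mat-cong (diagonal i e) (upper i e) (lower i e) (diagonal′ i e)
      where
      diagonal : ∀ i e → (1ℤ - (+ 4 * i) * e) * (1ℤ - (+ 4 * i) * (- e))
                         + (+ 2 * e) * (- ((+ 8 * i) * i * (- e))) ≡ 1ℤ
      diagonal = solve-∀
      upper : ∀ i e → (1ℤ - (+ 4 * i) * e) * (+ 2 * (- e)) + (+ 2 * e) * (1ℤ + (+ 4 * i) * (- e)) ≡ 0ℤ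
      upper = solve-∀
      lower : ∀ i e → (- ((+ 8 * i) * i * e)) * (1ℤ - (+ 4 * i) * (- e))
                      + (1ℤ + (+ 4 * i) * e) * (- ((+ 8 * i) * i * (- e))) ≡ 0ℤ
      lower = solve-∀
      diagonal′ : ∀ i e → (- ((+ 8 * i) * i * e)) * (+ 2 * (- e))
                          + (1ℤ + (+ 4 * i) * e) * (1ℤ + (+ 4 * i) * (- e)) ≡ 1ℤ
      diagonal′ = solve-∀

  Letter : ℕ → Set
  Letter q = Fin q × Bool

  infix 10 _⁻¹
  _⁻¹ : ∀ {q} → Letter q → Letter q
  (i , s) ⁻¹ = i , not s

  sign : Bool → ℤ
  sign true  = 1ℤ
  sign false = -[1+ 0 ]

  ι : ∀ {q} → Fin q → ℤ
  ι i = + toℕ i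

  gen : ∀ {q} → Letter q → Mat
  gen (i , s) = generator (ι i) (sign s)

  gen-⁻¹ : ∀ {q} (l : Letter q) → gen l ⊗ gen (l ⁻¹) ≡ 𝕀
  gen-⁻¹ (i , s) = subst (λ e → generator (ι i) (sign s) ⊗ generator (ι i) e ≡ 𝕀)
                          (sign-not s) (generator-inverse (ι i) (sign s))
    where
    sign-not : ∀ s → - sign s ≡ sign (not s)
    sign-not true  = refl
    sign-not false = refl

  Word : ℕ → Set
  Word q = List (Letter q)

  -- The head of a word is its last letter.
  val : ∀ {q} → Word q → Mat
  val []      = 𝕀
  val (l ∷ w) = val w ⊗ gen l

  Reduced : ∀ {q} → Word q → Set
  Reduced = Linked (λ l l′ → l ≢ l′ ⁻¹)

  val-∷-· : ∀ {q} i s (w : Word q) v → val ((i , s) ∷ w) · v ≡ val w · conjugate (ι i) (sign s) v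
  val-∷-· i s w v = trans (·-⊗ (val w) (gen (i , s)) v) (cong (val w ·_) (generator-· (ι i) (sign s) v))

  sign*[1+k]≢0 : ∀ s k → sign s * + suc k ≢ 0ℤ
  sign*[1+k]≢0 true  k ()
  sign*[1+k]≢0 false k ()

  same-sign : ∀ {q} {i : Fin q} {s t} → (i , s) ≢ (i , t) ⁻¹ → t ≡ s
  same-sign {s = true}  {true}  _ = refl
  same-sign {s = false} {false} _ = refl
  same-sign {s = true}  {false} ≢ = contradiction refl ≢
  same-sign {s = false} {true}  ≢ = contradiction refl ≢

  -- Ping-pong, one syllable gᵢᵉ of the word at a time: a syllable maps Steep[ i ] into Flat[ i ], and
  -- Flat[ i ] ⊆ Steep[ j ] for the index j ≠ i of the next syllable. Here k + 1 letters of the current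
  -- syllable have been read.
  pingPong : ∀ {q} {i : Fin q} {s w} k v → Reduced ((i , s) ∷ w) → Steep[ ι i ] v →
    Σ (Fin q) λ j → Flat[ ι j ] (val w · conjugate (ι i) (sign s * + suc k) v)
  pingPong {i = i} {s} {[]} k v _ steep =
    i , subst Flat[ ι i ] (sym (𝕀-· (conjugate (ι i) (sign s * + suc k) v)))
                          (conjugate-Steep⇒Flat (ι i) (sign s * + suc k) v (sign*[1+k]≢0 s k) steep)
  pingPong {i = i} {s} {(j , t) ∷ w} k v red steep with j ≟ i
  ... | no j≢i = j′ , subst Flat[ ι j′ ] (sym next) flat
    where
    u = conjugate (ι i) (sign s * + suc k) v
    u-steep : Steep[ ι j ] u
    u-steep = Flat[i]⇒Steep[j] (ι i) (ι j) u (j≢i ∘ sym ∘ toℕ-injective ∘ ℤ.+-injective)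
                (conjugate-Steep⇒Flat (ι i) (sign s * + suc k) v (sign*[1+k]≢0 s k) steep)
    next : val ((j , t) ∷ w) · u ≡ val w · conjugate (ι j) (sign t * + 1) u
    next = trans (val-∷-· j t w u) (cong (λ e → val w · conjugate (ι j) e u) (sym (ℤ.*-identityʳ (sign t))))
    j′ = proj₁ (pingPong 0 u (Linked.tail red) u-steep)
    flat = proj₂ (pingPong 0 u (Linked.tail red) u-steep)
  ... | yes refl with same-sign (Linked.head red)
  ...   | refl = j′ , subst Flat[ ι j′ ] (sym next) flat
    where
    u = conjugate (ι i) (sign s * + suc k) v
    next : val ((i , s) ∷ w) · u ≡ val w · conjugate (ι i) (sign s * + suc (suc k)) v
    next = trans (val-∷-· i s w u) (cong (val w ·_)
             (trans (conjugate-+ (ι i) (sign s) (sign s * + suc k) v)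
                    (cong (λ e → conjugate (ι i) e v) (distribute (sign s) (+ suc k)))))
      where
      distribute : ∀ e n → e + e * n ≡ e * (1ℤ + n)
      distribute = solve-∀
    j′ = proj₁ (pingPong (suc k) v (Linked.tail red) steep)
    flat = proj₂ (pingPong (suc k) v (Linked.tail red) steep)

  val≢𝕀 : ∀ {q} {l : Letter q} {w} → Reduced (l ∷ w) → val (l ∷ w) ≢ 𝕀
  val≢𝕀 {q} {i , s} {w} red val≡𝕀 = Flat-Steep-disjoint (B (- ι j) v₀) flat (v₀-steep j)
    where
    -- v₀ lies in Flat[ -1 ], hence in Steep[ ι j ] for every letter index j.
    v₀ = vec 1ℤ -[1+ 1 ]
    v₀-steep : ∀ j → Steep[ ι {q} j ] v₀
    v₀-steep j = Flat[i]⇒Steep[j] -[1+ 0 ] (ι j) v₀ (λ ()) (s≤s z≤n)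
    returns : val w · conjugate (ι i) (sign s * + 1) v₀ ≡ v₀
    returns = begin
      val w · conjugate (ι i) (sign s * + 1) v₀
        ≡⟨ cong (λ e → val w · conjugate (ι i) e v₀) (ℤ.*-identityʳ (sign s)) ⟩
      val w · conjugate (ι i) (sign s) v₀        ≡⟨ val-∷-· i s w v₀ ⟨
      val ((i , s) ∷ w) · v₀                     ≡⟨ cong (_· v₀) val≡𝕀 ⟩
      𝕀 · v₀                                     ≡⟨ 𝕀-· v₀ ⟩
      v₀                                         ∎
      where open ≡-Reasoning
    j = proj₁ (pingPong 0 v₀ red (v₀-steep i))
    flat = subst Flat[ ι j ] returns (proj₂ (pingPong 0 v₀ red (v₀-steep i)))

module FreeReduction where
  import Data.Bool as Bool using (_≟_)
  open import Data.Nat using (_≤_)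
  open import Data.Bool.Properties using (not-involutive)
  open import Data.Product.Properties using (≡-dec)
  open import Relation.Binary.Definitions using (DecidableEquality)

  open Matrices
  open PingPong

  ⁻¹-involutive : ∀ {q} (l : Letter q) → l ⁻¹ ⁻¹ ≡ l
  ⁻¹-involutive (i , s) = cong (i ,_) (not-involutive s)

  infix 4 _≟ₗ_
  _≟ₗ_ : ∀ {q} → DecidableEquality (Letter q)
  _≟ₗ_ = ≡-dec _≟_ Bool._≟_

  push : ∀ {q} → Word q → Letter q → Word q
  push []       l = l ∷ []
  push (l′ ∷ w) l with l ≟ₗ l′ ⁻¹
  ... | yes _ = w
  ... | no  _ = l ∷ l′ ∷ w

  push-reduced : ∀ {q} {w : Word q} l → Reduced w → Reduced (push w l)
  push-reduced {w = []}     l _   = [-]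
  push-reduced {w = l′ ∷ w} l red with l ≟ₗ l′ ⁻¹
  ... | yes _  = Linked.tail red
  ... | no l≢ = l≢ ∷ red

  length-push : ∀ {q} (w : Word q) l → length (push w l) ≤ suc (length w)
  length-push []       l = ℕ.≤-refl
  length-push (l′ ∷ w) l with l ≟ₗ l′ ⁻¹
  ... | yes _ = ℕ.≤-trans (ℕ.n≤1+n (length w)) (ℕ.n≤1+n (suc (length w)))
  ... | no  _ = ℕ.≤-refl

  val-push : ∀ {q} (w : Word q) l → val (push w l) ≡ val w ⊗ gen l
  val-push []       l = refl
  val-push (l′ ∷ w) l with l ≟ₗ l′ ⁻¹
  ... | no  _    = refl
  ... | yes refl = begin
    val w                            ≡⟨ ⊗-identityʳ (val w) ⟨
    val w ⊗ 𝕀                        ≡⟨ cong (val w ⊗_) (gen-⁻¹ l′) ⟨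
    val w ⊗ (gen l′ ⊗ gen (l′ ⁻¹))   ≡⟨ ⊗-assoc (val w) (gen l′) (gen (l′ ⁻¹)) ⟨
    val w ⊗ gen l′ ⊗ gen (l′ ⁻¹)     ∎
    where open ≡-Reasoning

  push-⁻¹≡[] : ∀ {q} (w : Word q) l → push w (l ⁻¹) ≡ [] → w ≡ l ∷ []
  push-⁻¹≡[] []       l ()
  push-⁻¹≡[] (l′ ∷ w) l w≡[] with l ⁻¹ ≟ₗ l′ ⁻¹
  ... | yes l⁻¹≡l′⁻¹ = cong₂ _∷_ l′≡l w≡[]
    where
    l′≡l : l′ ≡ l
    l′≡l = trans (sym (⁻¹-involutive l′)) (trans (cong _⁻¹ (sym l⁻¹≡l′⁻¹)) (⁻¹-involutive l))
  push-⁻¹≡[] (l′ ∷ w) l () | no _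

  last-push : ∀ {q} (w : Word q) l {l₀} → last (push w l) ≡ just l₀ → (w ≡ [] × l ≡ l₀) ⊎ last w ≡ just l₀
  last-push []       l eq = inj₁ (refl , just-injective eq)
  last-push (l′ ∷ w) l eq with l ≟ₗ l′ ⁻¹
  last-push (l′ ∷ [])     l () | yes _
  last-push (l′ ∷ l″ ∷ w) l eq | yes _ = inj₂ eq
  last-push (l′ ∷ w)      l eq | no  _ = inj₂ eq

module EntryBounds where
  open import Data.Nat using (_≤_)
  open import Data.Integer using (ℤ; +_; -[1+_]; _+_; _*_; -_; _-_; ∣_∣; 1ℤ)
  import Data.Integer.Properties as ℤ
  open import Data.Fin.Properties using (toℕ<n)

  open Matrices
  open PingPong

  entryBound : ℕ → ℕ
  entryBound q = 16 ℕ.* (q ℕ.* q) ℕ.+ 2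

  infix 4 ∥_∥≤_
  record ∥_∥≤_ (M : Mat) (K : ℕ) : Set where
    constructor bounded
    field
      a : ∣ Mat.a M ∣ ≤ K
      b : ∣ Mat.b M ∣ ≤ K
      c : ∣ Mat.c M ∣ ≤ K
      d : ∣ Mat.d M ∣ ≤ K

  ∣xy+zw∣≤ : ∀ x y z w {K K′} → ∣ x ∣ ≤ K → ∣ y ∣ ≤ K′ → ∣ z ∣ ≤ K → ∣ w ∣ ≤ K′ →
    ∣ x * y + z * w ∣ ≤ 2 ℕ.* (K ℕ.* K′)
  ∣xy+zw∣≤ x y z w {K} {K′} ∣x∣≤ ∣y∣≤ ∣z∣≤ ∣w∣≤ = begin
    ∣ x * y + z * w ∣                   ≤⟨ ℤ.∣i+j∣≤∣i∣+∣j∣ (x * y) (z * w) ⟩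
    ∣ x * y ∣ ℕ.+ ∣ z * w ∣             ≡⟨ cong₂ ℕ._+_ (ℤ.abs-* x y) (ℤ.abs-* z w) ⟩
    ∣ x ∣ ℕ.* ∣ y ∣ ℕ.+ ∣ z ∣ ℕ.* ∣ w ∣
      ≤⟨ ℕ.+-mono-≤ (ℕ.*-mono-≤ ∣x∣≤ ∣y∣≤) (ℕ.*-mono-≤ ∣z∣≤ ∣w∣≤) ⟩
    K ℕ.* K′ ℕ.+ K ℕ.* K′               ≡⟨ cong (K ℕ.* K′ ℕ.+_) (ℕ.+-identityʳ (K ℕ.* K′)) ⟨
    2 ℕ.* (K ℕ.* K′)                    ∎
    where open ℕ.≤-Reasoning

  ∥⊗∥≤ : ∀ {M N K K′} → ∥ M ∥≤ K → ∥ N ∥≤ K′ → ∥ M ⊗ N ∥≤ 2 ℕ.* (K ℕ.* K′)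
  ∥⊗∥≤ {mat x y z w} {mat x′ y′ z′ w′} (bounded a b c d) (bounded a′ b′ c′ d′) = bounded
    (∣xy+zw∣≤ x x′ y z′ a a′ b c′) (∣xy+zw∣≤ x y′ y w′ a b′ b d′)
    (∣xy+zw∣≤ z x′ w z′ c a′ d c′) (∣xy+zw∣≤ z y′ w w′ c b′ d d′)

  ∥𝕀∥≤1 : ∥ 𝕀 ∥≤ 1
  ∥𝕀∥≤1 = bounded (s≤s z≤n) z≤n z≤n (s≤s z≤n)

  ∣x*sign∣≡∣x∣ : ∀ x s → ∣ x * sign s ∣ ≡ ∣ x ∣
  ∣x*sign∣≡∣x∣ x true  = trans (ℤ.abs-* x 1ℤ) (ℕ.*-identityʳ ∣ x ∣)
  ∣x*sign∣≡∣x∣ x false = trans (ℤ.abs-* x -[1+ 0 ]) (ℕ.*-identityʳ ∣ x ∣)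

  opaque
    unfolding generator

    ∥gen∥≤ : ∀ {q} (l : Letter q) → ∥ gen l ∥≤ entryBound q
    ∥gen∥≤ {q} (i , s) = bounded ∣a∣ ∣b∣ ∣c∣ ∣d∣
      where
      open ℕ.≤-Reasoning
      i<q : toℕ i ℕ.< q
      i<q = toℕ<n i
      i≤q² : toℕ i ≤ q ℕ.* q
      i≤q² = ℕ.≤-trans (ℕ.<⇒≤ i<q) (ℕ.m≤m*n q q {{ℕ.>-nonZero (ℕ.≤-<-trans z≤n i<q)}})
      i²≤q² : toℕ i ℕ.* toℕ i ≤ q ℕ.* q
      i²≤q² = ℕ.*-mono-≤ (ℕ.<⇒≤ i<q) (ℕ.<⇒≤ i<q)
      ∣4ie∣ : ∣ (+ 4 * ι i) * sign s ∣ ≡ 4 ℕ.* toℕ i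
      ∣4ie∣ = trans (∣x*sign∣≡∣x∣ (+ 4 * ι i) s) (ℤ.abs-* (+ 4) (ι i))
      diagonal : ∀ z → ∣ z ∣ ≡ 4 ℕ.* toℕ i → ∣ 1ℤ + z ∣ ≤ entryBound q
      diagonal z ∣z∣≡ = begin
        ∣ 1ℤ + z ∣                 ≤⟨ ℤ.∣i+j∣≤∣i∣+∣j∣ 1ℤ z ⟩
        1 ℕ.+ ∣ z ∣                ≡⟨ cong suc ∣z∣≡ ⟩
        1 ℕ.+ 4 ℕ.* toℕ i
          ≤⟨ ℕ.+-mono-≤ {1} {2} (s≤s z≤n) (ℕ.*-mono-≤ {4} {16} (ℕ.m≤m+n 4 12) i≤q²) ⟩
        2 ℕ.+ 16 ℕ.* (q ℕ.* q)     ≡⟨ ℕ.+-comm 2 (16 ℕ.* (q ℕ.* q)) ⟩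
        entryBound q               ∎
      ∣a∣ : ∣ 1ℤ - (+ 4 * ι i) * sign s ∣ ≤ entryBound q
      ∣a∣ = diagonal (- ((+ 4 * ι i) * sign s)) (trans (ℤ.∣-i∣≡∣i∣ ((+ 4 * ι i) * sign s)) ∣4ie∣)
      ∣b∣ : ∣ + 2 * sign s ∣ ≤ entryBound q
      ∣b∣ = begin
        ∣ + 2 * sign s ∣           ≡⟨ ∣x*sign∣≡∣x∣ (+ 2) s ⟩
        2                          ≤⟨ ℕ.m≤n+m 2 (16 ℕ.* (q ℕ.* q)) ⟩
        entryBound q               ∎
      ∣c∣ : ∣ - ((+ 8 * ι i) * ι i * sign s) ∣ ≤ entryBound q
      ∣c∣ = begin
        ∣ - ((+ 8 * ι i) * ι i * sign s) ∣  ≡⟨ ℤ.∣-i∣≡∣i∣ ((+ 8 * ι i) * ι i * sign s) ⟩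
        ∣ (+ 8 * ι i) * ι i * sign s ∣      ≡⟨ ∣x*sign∣≡∣x∣ ((+ 8 * ι i) * ι i) s ⟩
        ∣ (+ 8 * ι i) * ι i ∣               ≡⟨ ℤ.abs-* (+ 8 * ι i) (ι i) ⟩
        ∣ + 8 * ι i ∣ ℕ.* toℕ i             ≡⟨ cong (ℕ._* toℕ i) (ℤ.abs-* (+ 8) (ι i)) ⟩
        8 ℕ.* toℕ i ℕ.* toℕ i               ≡⟨ ℕ.*-assoc 8 (toℕ i) (toℕ i) ⟩
        8 ℕ.* (toℕ i ℕ.* toℕ i)             ≤⟨ ℕ.*-mono-≤ {8} {16} (ℕ.m≤m+n 8 8) i²≤q² ⟩
        16 ℕ.* (q ℕ.* q)                    ≤⟨ ℕ.m≤m+n (16 ℕ.* (q ℕ.* q)) 2 ⟩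
        entryBound q                        ∎
      ∣d∣ : ∣ 1ℤ + (+ 4 * ι i) * sign s ∣ ≤ entryBound q
      ∣d∣ = diagonal ((+ 4 * ι i) * sign s) ∣4ie∣

  ∥val∥≤ : ∀ {q} (w : Word q) → ∥ val w ∥≤ (2 ℕ.* entryBound q) ℕ.^ length w
  ∥val∥≤ []               = ∥𝕀∥≤1
  ∥val∥≤ {q} (l ∷ w) = subst (∥ val (l ∷ w) ∥≤_) (regroup ((2 ℕ.* entryBound q) ℕ.^ length w) (entryBound q))
                                 (∥⊗∥≤ (∥val∥≤ w) (∥gen∥≤ l))
    where
    regroup : ∀ x g → 2 ℕ.* (x ℕ.* g) ≡ 2 ℕ.* g ℕ.* x
    regroup x g = trans (cong (2 ℕ.*_) (ℕ.*-comm x g)) (sym (ℕ.*-assoc 2 g x))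

module Arithmetic where
  open import Data.Nat
  open import Data.Nat.Properties
  open import Data.Nat.DivMod using (_/_; _%_; m/n*n≤m; m≡m%n+[m/n]*n; m%n<n; m/n≤m; m*n/n≡m; /-monoˡ-≤)
  open import Data.Nat.Logarithm using (⌊log₂_⌋; ⌊log₂⌋-mono-≤; ⌊log₂⌊n/2⌋⌋≡⌊log₂n⌋∸1; ⌊log₂[2^n]⌋≡n)
  open import Data.Nat.Induction using (<-rec)
  open import Data.Nat.Tactic.RingSolver using (solve-∀)

  open EntryBounds using (entryBound)

  2^k≤n⇒k≤⌊log₂n⌋ : ∀ {k n} → 2 ^ k ≤ n → k ≤ ⌊log₂ n ⌋
  2^k≤n⇒k≤⌊log₂n⌋ {k} {n} le = subst (_≤ ⌊log₂ n ⌋) (⌊log₂[2^n]⌋≡n k) (⌊log₂⌋-mono-≤ le)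

  n<2^[1+⌊log₂n⌋] : ∀ n → n < 2 ^ suc ⌊log₂ n ⌋
  n<2^[1+⌊log₂n⌋] n with 2 ^ suc ⌊log₂ n ⌋ ≤? n
  ... | yes le = contradiction (2^k≤n⇒k≤⌊log₂n⌋ le) (1+n≰n)
  ... | no ≰ = ≰⇒> ≰

  2^⌊log₂n⌋≤n : ∀ n → 1 ≤ n → 2 ^ ⌊log₂ n ⌋ ≤ n
  2^⌊log₂n⌋≤n = <-rec (λ n → 1 ≤ n → 2 ^ ⌊log₂ n ⌋ ≤ n) step
    where
    step : ∀ n → (∀ {m} → m < n → 1 ≤ m → 2 ^ ⌊log₂ m ⌋ ≤ m) → 1 ≤ n → 2 ^ ⌊log₂ n ⌋ ≤ n
    step (suc zero) _ _ = ≤-refl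
    step (suc (suc n)) rec _ = begin
      2 ^ ⌊log₂ (2 + n) ⌋       ≡⟨ cong (2 ^_) log-halves ⟩
      2 * 2 ^ ⌊log₂ half ⌋      ≤⟨ *-monoʳ-≤ 2 (rec (⌊n/2⌋<n (suc n)) (s≤s z≤n)) ⟩
      half + (half + 0)         ≤⟨ +-monoʳ-≤ half (≤-reflexive (+-identityʳ half)) ⟩
      half + half               ≤⟨ +-monoʳ-≤ half (⌊n/2⌋≤⌈n/2⌉ (2 + n)) ⟩
      half + ⌈ 2 + n /2⌉        ≡⟨ ⌊n/2⌋+⌈n/2⌉≡n (2 + n) ⟩
      2 + n                     ∎
      where
      open ≤-Reasoning
      half = ⌊ 2 + n /2⌋
      log-halves : ⌊log₂ (2 + n) ⌋ ≡ suc ⌊log₂ half ⌋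
      log-halves = trans (sym (m+[n∸m]≡n (2^k≤n⇒k≤⌊log₂n⌋ {1} {2 + n} (s≤s (s≤s z≤n)))))
                         (cong suc (sym (⌊log₂⌊n/2⌋⌋≡⌊log₂n⌋∸1 (2 + n))))

  16[8+j]+72≤2^[8+j] : ∀ j → 16 * (8 + j) + 72 ≤ 2 ^ (8 + j)
  16[8+j]+72≤2^[8+j] zero = m≤m+n 200 56
  16[8+j]+72≤2^[8+j] (suc j) = begin
    16 * (8 + suc j) + 72                  ≤⟨ m≤m+n _ (16 * (8 + j) + 56) ⟩
    16 * (8 + suc j) + 72 + (16 * (8 + j) + 56) ≡⟨ doubling j ⟩
    2 * (16 * (8 + j) + 72)                ≤⟨ *-monoʳ-≤ 2 (16[8+j]+72≤2^[8+j] j) ⟩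
    2 ^ (8 + suc j)                        ∎
    where
    open ≤-Reasoning
    doubling : ∀ j → 16 * (8 + suc j) + 72 + (16 * (8 + j) + 56) ≡ 2 * (16 * (8 + j) + 72)
    doubling = solve-∀

  record Parameters (n : ℕ) : Set where
    field
      k q        : ℕ
      2≤q        : 2 ≤ q
      fits       : (2 ^ k) ^ 4 ≤ n
      separates  : suc ((2 * entryBound q) ^ q) < 2 ^ k
      rounds⇒log : ∀ {t} → q ≤ t → ⌊log₂ n ⌋ ≤ 25 * (t * ⌊log₂ ⌊log₂ n ⌋ ⌋)

  -- As q ≤ ℓ < 2^(ℓ′+1), 2 · entryBound q ≤ 2^s, hence (2 · entryBound q)^q ≤ 2^(qs) < 2ᵏ, while
  -- (2ᵏ)⁴ = 2^(4qs+8) ≤ 2^ℓ ≤ n.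
  module Choice (n : ℕ) (n≥2^256 : 2 ^ 256 ≤ n) where
    open ≤-Reasoning

    ℓ ℓ′ s d q k : ℕ
    ℓ = ⌊log₂ n ⌋
    ℓ′ = ⌊log₂ ℓ ⌋
    s = 8 + 2 * ℓ′
    d = ℓ ∸ 8
    q = d / (4 * s)
    k = q * s + 2

    256≤ℓ : 256 ≤ ℓ
    256≤ℓ = 2^k≤n⇒k≤⌊log₂n⌋ n≥2^256
    8≤ℓ′ : 8 ≤ ℓ′
    8≤ℓ′ = 2^k≤n⇒k≤⌊log₂n⌋ {8} {ℓ} 256≤ℓ
    d+8≡ℓ : d + 8 ≡ ℓ
    d+8≡ℓ = m∸n+n≡m (≤-trans (m≤m+n 8 248) 256≤ℓ)

    8s+8≤ℓ : 8 * s + 8 ≤ ℓ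
    8s+8≤ℓ = begin
      8 * s + 8                   ≡⟨ rearrange ℓ′ ⟩
      16 * ℓ′ + 72                ≡⟨ cong (λ j → 16 * j + 72) (m+[n∸m]≡n 8≤ℓ′) ⟨
      16 * (8 + (ℓ′ ∸ 8)) + 72    ≤⟨ 16[8+j]+72≤2^[8+j] (ℓ′ ∸ 8) ⟩
      2 ^ (8 + (ℓ′ ∸ 8))          ≡⟨ cong (2 ^_) (m+[n∸m]≡n 8≤ℓ′) ⟩
      2 ^ ℓ′                      ≤⟨ 2^⌊log₂n⌋≤n ℓ (≤-trans (s≤s z≤n) 256≤ℓ) ⟩
      ℓ                           ∎
      where
      rearrange : ∀ j → 8 * (8 + 2 * j) + 8 ≡ 16 * j + 72
      rearrange = solve-∀

    q*4s≤d : q * (4 * s) ≤ d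
    q*4s≤d = m/n*n≤m d (4 * s)

    d<[1+q]*4s : d < suc q * (4 * s)
    d<[1+q]*4s = begin-strict
      d                          ≡⟨ m≡m%n+[m/n]*n d (4 * s) ⟩
      d % (4 * s) + q * (4 * s)  <⟨ +-monoˡ-< (q * (4 * s)) (m%n<n d (4 * s)) ⟩
      suc q * (4 * s)            ∎

    2≤q : 2 ≤ q
    2≤q = begin
      2                          ≡⟨ m*n/n≡m 2 (4 * s) ⟨
      2 * (4 * s) / (4 * s)      ≤⟨ /-monoˡ-≤ (4 * s) 8s≤d ⟩
      q                          ∎
      where
      8s≤d : 2 * (4 * s) ≤ d
      8s≤d = begin
        2 * (4 * s)              ≡⟨ *-assoc 2 4 s ⟨
        8 * s                    ≡⟨ m+n∸n≡m (8 * s) 8 ⟨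
        8 * s + 8 ∸ 8            ≤⟨ ∸-monoˡ-≤ 8 8s+8≤ℓ ⟩
        d                        ∎

    fits : (2 ^ k) ^ 4 ≤ n
    fits = begin
      (2 ^ k) ^ 4                ≡⟨ ^-*-assoc 2 k 4 ⟩
      2 ^ (k * 4)                ≡⟨ cong (2 ^_) (regroup q s) ⟩
      2 ^ (q * (4 * s) + 8)      ≤⟨ ^-monoʳ-≤ 2 (+-monoˡ-≤ 8 q*4s≤d) ⟩
      2 ^ (d + 8)                ≡⟨ cong (2 ^_) d+8≡ℓ ⟩
      2 ^ ℓ                      ≤⟨ 2^⌊log₂n⌋≤n n (≤-trans (m^n>0 2 256) n≥2^256) ⟩
      n                          ∎
      where
      regroup : ∀ q s → (q * s + 2) * 4 ≡ q * (4 * s) + 8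
      regroup = solve-∀

    separates : suc ((2 * entryBound q) ^ q) < 2 ^ k
    separates = begin-strict
      suc ((2 * entryBound q) ^ q)   ≤⟨ s≤s (^-monoˡ-≤ q 2G≤2^s) ⟩
      suc ((2 ^ s) ^ q)              ≡⟨ cong suc (trans (^-*-assoc 2 s q) (cong (2 ^_) (*-comm s q))) ⟩
      suc X                          <⟨ +-monoˡ-≤ X (*-monoʳ-≤ 2 (m^n>0 2 (q * s))) ⟩
      2 * X + X                      ≤⟨ m≤m+n (2 * X + X) X ⟩
      2 * X + X + X                  ≡⟨ times4 X ⟩
      X * 4                          ≡⟨ ^-distribˡ-+-* 2 (q * s) 2 ⟨
      2 ^ k                          ∎
      where
      X = 2 ^ (q * s)
      times4 : ∀ x → 2 * x + x + x ≡ x * 4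
      times4 = solve-∀
      Q = 2 ^ suc ℓ′
      q≤Q : q ≤ Q
      q≤Q = <⇒≤ (≤-<-trans (≤-trans (m/n≤m d (4 * s)) (m∸n≤m ℓ 8)) (n<2^[1+⌊log₂n⌋] ℓ))
      1≤QQ : 1 ≤ Q * Q
      1≤QQ = *-mono-≤ (m^n>0 2 (suc ℓ′)) (m^n>0 2 (suc ℓ′))
      2G≤2^s : 2 * entryBound q ≤ 2 ^ s
      2G≤2^s = begin
        2 * (16 * (q * q) + 2)
          ≤⟨ *-monoʳ-≤ 2 (+-mono-≤ (*-monoʳ-≤ 16 (*-mono-≤ q≤Q q≤Q)) (*-monoʳ-≤ 2 1≤QQ)) ⟩
        2 * (16 * (Q * Q) + 2 * (Q * Q))  ≤⟨ m≤m+n _ (28 * (Q * Q)) ⟩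
        2 * (16 * (Q * Q) + 2 * (Q * Q)) + 28 * (Q * Q) ≡⟨ collect (Q * Q) ⟩
        2 ^ 6 * (Q * Q)                   ≡⟨ cong (2 ^ 6 *_) (^-distribˡ-+-* 2 (suc ℓ′) (suc ℓ′)) ⟨
        2 ^ 6 * 2 ^ (suc ℓ′ + suc ℓ′)     ≡⟨ ^-distribˡ-+-* 2 6 (suc ℓ′ + suc ℓ′) ⟨
        2 ^ (6 + (suc ℓ′ + suc ℓ′))       ≡⟨ cong (2 ^_) (exponent ℓ′) ⟩
        2 ^ s                             ∎
        where
        collect : ∀ x → 2 * (16 * x + 2 * x) + 28 * x ≡ 64 * x
        collect = solve-∀
        exponent : ∀ l → 6 + (suc l + suc l) ≡ 8 + 2 * l
        exponent = solve-∀

    rounds⇒log : ∀ {t} → q ≤ t → ℓ ≤ 25 * (t * ℓ′)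
    rounds⇒log {t} q≤t = begin
      ℓ                               ≡⟨ d+8≡ℓ ⟨
      d + 8                           ≤⟨ +-monoˡ-≤ 8 (<⇒≤ d<[1+q]*4s) ⟩
      suc q * (4 * s) + 8             ≤⟨ +-mono-≤ (*-mono-≤ 1+q≤t+t (*-monoʳ-≤ 4 s≤3ℓ′)) 8≤tℓ′ ⟩
      (t + t) * (4 * (3 * ℓ′)) + t * ℓ′ ≡⟨ collect t ℓ′ ⟩
      25 * (t * ℓ′)                   ∎
      where
      1≤t : 1 ≤ t
      1≤t = ≤-trans (≤-trans (s≤s z≤n) 2≤q) q≤t
      1+q≤t+t : suc q ≤ t + t
      1+q≤t+t = ≤-trans (s≤s q≤t) (+-monoˡ-≤ t 1≤t)
      s≤3ℓ′ : s ≤ 3 * ℓ′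
      s≤3ℓ′ = ≤-trans (+-monoˡ-≤ (2 * ℓ′) 8≤ℓ′) (≤-reflexive (thrice ℓ′))
        where
        thrice : ∀ l → l + 2 * l ≡ 3 * l
        thrice = solve-∀
      8≤tℓ′ : 8 ≤ t * ℓ′
      8≤tℓ′ = ≤-trans 8≤ℓ′ (≤-trans (≤-reflexive (sym (*-identityˡ ℓ′))) (*-monoˡ-≤ ℓ′ 1≤t))
      collect : ∀ t l → (t + t) * (4 * (3 * l)) + t * l ≡ 25 * (t * l)
      collect = solve-∀

  parameters : ∀ n → 2 ^ 256 ≤ n → Parameters n
  parameters n n≥2^256 = record
    { k = k ; q = q ; 2≤q = 2≤q ; fits = fits ; separates = separates ; rounds⇒log = rounds⇒log }
    where open Choice n n≥2^256

module Congruences (m : ℕ) .{{_ : NonZero m}} where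
  open import Data.Integer using (ℤ; +_; _+_; _*_; -_; _-_; ∣_∣; 0ℤ; 1ℤ)
  import Data.Integer.Properties as ℤ
  open import Data.Integer.Tactic.RingSolver using (solve-∀)
  open import Data.Fin.Properties using (toℕ<n; toℕ-injective; toℕ-fromℕ<)
  open import Data.Integer.DivMod using (_%ℕ_; _/ℕ_; n%ℕd<d; a≡a%ℕn+[a/ℕn]*n)
  open import Data.Integer.Divisibility.Signed
    using (_∣_; divides; _∣?_; ∣m∣n⇒∣m+n; ∣m⇒∣-m; ∣m⇒∣m*n; ∣n⇒∣m*n; ∣⇒∣ᵤ)
  import Data.Nat.Divisibility as ℕ using (∣⇒≤)
  import Relation.Nullary.Decidable as Dec
  open import Relation.Binary.Bundles using (Setoid)
  import Relation.Binary.Reasoning.Setoid as ≈-Reasoning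

  open Matrices
  open PingPong using (ι)
  open EntryBounds using (∥_∥≤_; bounded)

  infix 4 _≡ₘ_
  record _≡ₘ_ (a b : ℤ) : Set where
    constructor congruent
    field m∣a-b : + m ∣ a - b

  ≡ₘ-reflexive : ∀ {a b} → a ≡ b → a ≡ₘ b
  ≡ₘ-reflexive {a} refl = congruent (divides 0ℤ (ℤ.+-inverseʳ a))

  ≡ₘ-sym : ∀ {a b} → a ≡ₘ b → b ≡ₘ a
  ≡ₘ-sym {a} {b} (congruent a≡b) = congruent (subst (+ m ∣_) (flip a b) (∣m⇒∣-m a≡b))
    where
    flip : ∀ a b → - (a - b) ≡ b - a
    flip = solve-∀

  ≡ₘ-trans : ∀ {a b c} → a ≡ₘ b → b ≡ₘ c → a ≡ₘ c
  ≡ₘ-trans {a} {b} {c} (congruent a≡b) (congruent b≡c) =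
    congruent (subst (+ m ∣_) (telescope a b c) (∣m∣n⇒∣m+n a≡b b≡c))
    where
    telescope : ∀ a b c → (a - b) + (b - c) ≡ a - c
    telescope = solve-∀

  +-congₘ : ∀ {a b c d} → a ≡ₘ b → c ≡ₘ d → a + c ≡ₘ b + d
  +-congₘ {a} {b} {c} {d} (congruent a≡b) (congruent c≡d) =
    congruent (subst (+ m ∣_) (regroup a b c d) (∣m∣n⇒∣m+n a≡b c≡d))
    where
    regroup : ∀ a b c d → (a - b) + (c - d) ≡ a + c - (b + d)
    regroup = solve-∀

  -‿congₘ : ∀ {a b} → a ≡ₘ b → - a ≡ₘ - b
  -‿congₘ {a} {b} (congruent a≡b) = congruent (subst (+ m ∣_) (negate a b) (∣m⇒∣-m a≡b))
    where
    negate : ∀ a b → - (a - b) ≡ - a - - b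
    negate = solve-∀

  *-congₘ : ∀ {a b c d} → a ≡ₘ b → c ≡ₘ d → a * c ≡ₘ b * d
  *-congₘ {a} {b} {c} {d} (congruent a≡b) (congruent c≡d) =
    congruent (subst (+ m ∣_) (regroup a b c d) (∣m∣n⇒∣m+n (∣m⇒∣m*n c a≡b) (∣n⇒∣m*n b c≡d)))
    where
    regroup : ∀ a b c d → (a - b) * c + b * (c - d) ≡ a * c - b * d
    regroup = solve-∀

  ≡ₘ⇒≡ : ∀ {a b} → ∣ a - b ∣ ℕ.< m → a ≡ₘ b → a ≡ b
  ≡ₘ⇒≡ {a} {b} small (congruent a≡b) with ∣ a - b ∣ in eq | ∣⇒∣ᵤ a≡b
  ... | zero  | _ = ℤ.i-j≡0⇒i≡j a b (ℤ.∣i∣≡0⇒i≡0 eq)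
  ... | suc _ | m∣ = contradiction (ℕ.∣⇒≤ m∣) (ℕ.<⇒≱ small)

  infix 4 _≈_
  record _≈_ (M N : Mat) : Set where
    constructor entrywise
    field
      a : Mat.a M ≡ₘ Mat.a N
      b : Mat.b M ≡ₘ Mat.b N
      c : Mat.c M ≡ₘ Mat.c N
      d : Mat.d M ≡ₘ Mat.d N

  ≈-reflexive : ∀ {M N} → M ≡ N → M ≈ N
  ≈-reflexive refl = entrywise (≡ₘ-reflexive refl) (≡ₘ-reflexive refl) (≡ₘ-reflexive refl) (≡ₘ-reflexive refl)

  ≈-refl : ∀ {M} → M ≈ M
  ≈-refl = ≈-reflexive refl

  ≈-sym : ∀ {M N} → M ≈ N → N ≈ M
  ≈-sym (entrywise a b c d) = entrywise (≡ₘ-sym a) (≡ₘ-sym b) (≡ₘ-sym c) (≡ₘ-sym d)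

  ≈-trans : ∀ {L M N} → L ≈ M → M ≈ N → L ≈ N
  ≈-trans (entrywise a b c d) (entrywise a′ b′ c′ d′) =
    entrywise (≡ₘ-trans a a′) (≡ₘ-trans b b′) (≡ₘ-trans c c′) (≡ₘ-trans d d′)

  ≈-setoid : Setoid 0ℓ 0ℓ
  ≈-setoid = record
    { Carrier = Mat ; _≈_ = _≈_
    ; isEquivalence = record { refl = ≈-refl ; sym = ≈-sym ; trans = ≈-trans } }

  ⊗-cong : ∀ {M M′ N N′} → M ≈ M′ → N ≈ N′ → M ⊗ N ≈ M′ ⊗ N′
  ⊗-cong (entrywise a b c d) (entrywise a′ b′ c′ d′) = entrywise
    (+-congₘ (*-congₘ a a′) (*-congₘ b c′)) (+-congₘ (*-congₘ a b′) (*-congₘ b d′))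
    (+-congₘ (*-congₘ c a′) (*-congₘ d c′)) (+-congₘ (*-congₘ c b′) (*-congₘ d d′))

  det-cong : ∀ {M N} → M ≈ N → det M ≡ₘ det N
  det-cong (entrywise a b c d) = +-congₘ (*-congₘ a d) (-‿congₘ (*-congₘ b c))

  •-identityₘ : ∀ {s} X → s ≡ₘ 1ℤ → s • X ≈ X
  •-identityₘ {s} (mat a b c d) s≡1 = entrywise (scale a) (scale b) (scale c) (scale d)
    where
    scale : ∀ x → s * x ≡ₘ x
    scale x = subst (s * x ≡ₘ_) (ℤ.*-identityˡ x) (*-congₘ s≡1 (≡ₘ-reflexive refl))

  ⊗-cancelˡ : ∀ {M X Y} → det M ≡ₘ 1ℤ → M ⊗ X ≈ M ⊗ Y → X ≈ Y
  ⊗-cancelˡ {M} {X} {Y} det≡1 MX≈MY = begin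
    X                            ≈⟨ •-identityₘ X det≡1 ⟨
    det M • X                    ≡⟨ adjugate-⊗ M X ⟨
    adjugate M ⊗ (M ⊗ X)         ≈⟨ ⊗-cong (≈-refl {adjugate M}) MX≈MY ⟩
    adjugate M ⊗ (M ⊗ Y)         ≡⟨ adjugate-⊗ M Y ⟩
    det M • Y                    ≈⟨ •-identityₘ Y det≡1 ⟩
    Y                            ∎
    where open ≈-Reasoning ≈-setoid

  ≈𝕀⇒≡𝕀 : ∀ {M K} → ∥ M ∥≤ K → suc K ℕ.< m → M ≈ 𝕀 → M ≡ 𝕀
  ≈𝕀⇒≡𝕀 {mat a b c d} {K} (bounded ∣a∣ ∣b∣ ∣c∣ ∣d∣) K<m (entrywise a≡1 b≡0 c≡0 d≡1) =
    mat-cong (near ∣a∣ (s≤s z≤n) a≡1) (near ∣b∣ z≤n b≡0) (near ∣c∣ z≤n c≡0) (near ∣d∣ (s≤s z≤n) d≡1)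
    where
    near : ∀ {x y} → ∣ x ∣ ℕ.≤ K → ∣ y ∣ ℕ.≤ 1 → x ≡ₘ y → x ≡ y
    near {x} {y} ∣x∣≤K ∣y∣≤1 = ≡ₘ⇒≡ (ℕ.≤-<-trans (ℤ.∣i-j∣≤∣i∣+∣j∣ x y)
      (ℕ.≤-<-trans (ℕ.+-mono-≤ ∣x∣≤K ∣y∣≤1) (subst (ℕ._< m) (ℕ.+-comm 1 K) K<m)))

  residue : ℤ → Fin m
  residue z = fromℕ< (n%ℕd<d z m)

  residue-≡ₘ : ∀ z → ι (residue z) ≡ₘ z
  residue-≡ₘ z = congruent (divides (- (z /ℕ m)) (begin
    + toℕ (residue z) - z                        ≡⟨ cong (λ r → + r - z) (toℕ-fromℕ< (n%ℕd<d z m)) ⟩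
    + (z %ℕ m) - z                               ≡⟨ cong (λ y → + (z %ℕ m) - y) (a≡a%ℕn+[a/ℕn]*n z m) ⟩
    + (z %ℕ m) - (+ (z %ℕ m) + (z /ℕ m) * + m)   ≡⟨ cancel (+ (z %ℕ m)) (z /ℕ m) (+ m) ⟩
    - (z /ℕ m) * + m                             ∎))
    where
    open ≡-Reasoning
    cancel : ∀ r q m → r - (r + q * m) ≡ - q * m
    cancel = solve-∀

  ι-≡ₘ-injective : ∀ {i j : Fin m} → ι i ≡ₘ ι j → i ≡ j
  ι-≡ₘ-injective {i} {j} i≡j = toℕ-injective (ℤ.+-injective (≡ₘ⇒≡ close i≡j))
    where
    close : ∣ ι i - ι j ∣ ℕ.< m
    close = subst (ℕ._< m) (cong ∣_∣ (sym (ℤ.m-n≡m⊖n (toℕ i) (toℕ j))))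
              (ℕ.≤-<-trans (ℤ.∣m⊝n∣≤m⊔n (toℕ i) (toℕ j)) (ℕ.⊔-lub (toℕ<n i) (toℕ<n j)))

  MatMod : Set
  MatMod = Fin m × Fin m × Fin m × Fin m

  lift : MatMod → Mat
  lift (a , b , c , d) = mat (ι a) (ι b) (ι c) (ι d)

  reduce : Mat → MatMod
  reduce (mat a b c d) = residue a , residue b , residue c , residue d

  lift-reduce : ∀ M → lift (reduce M) ≈ M
  lift-reduce (mat a b c d) = entrywise (residue-≡ₘ a) (residue-≡ₘ b) (residue-≡ₘ c) (residue-≡ₘ d)

  lift-injective : ∀ {c c′} → lift c ≈ lift c′ → c ≡ c′
  lift-injective (entrywise a b c d) =
    cong₂ _,_ (ι-≡ₘ-injective a) (cong₂ _,_ (ι-≡ₘ-injective b) (cong₂ _,_ (ι-≡ₘ-injective c) (ι-≡ₘ-injective d)))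

  reduce-cong : ∀ {M N} → M ≈ N → reduce M ≡ reduce N
  reduce-cong {M} {N} M≈N = lift-injective (≈-trans (lift-reduce M) (≈-trans M≈N (≈-sym (lift-reduce N))))

  reduce-lift : ∀ c → reduce (lift c) ≡ c
  reduce-lift c = lift-injective (lift-reduce (lift c))

  infixl 6 _◃_
  _◃_ : MatMod → Mat → MatMod
  c ◃ M = reduce (lift c ⊗ M)

  ◃-𝕀 : ∀ c → c ◃ 𝕀 ≡ c
  ◃-𝕀 c = trans (cong reduce (⊗-identityʳ (lift c))) (reduce-lift c)

  ◃-⊗ : ∀ c M N → c ◃ M ◃ N ≡ c ◃ (M ⊗ N)
  ◃-⊗ c M N = reduce-cong (≈-trans (⊗-cong (lift-reduce (lift c ⊗ M)) (≈-refl {N}))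
                                   (≈-reflexive (⊗-assoc (lift c) M N)))

  Unimodular : MatMod → Set
  Unimodular c = det (lift c) ≡ₘ 1ℤ

  unimodular? : Decidable Unimodular
  unimodular? c = Dec.map′ congruent _≡ₘ_.m∣a-b (+ m ∣? (det (lift c) - 1ℤ))

  ◃-unimodular : ∀ {c M} → det M ≡ 1ℤ → Unimodular c → Unimodular (c ◃ M)
  ◃-unimodular {c} {M} det≡1 c-unimodular =
    ≡ₘ-trans (det-cong {lift (c ◃ M)} {lift c ⊗ M} (lift-reduce (lift c ⊗ M)))
             (subst (_≡ₘ 1ℤ) (sym det[cM]≡det[c]) c-unimodular)
    where
    det[cM]≡det[c] : det (lift c ⊗ M) ≡ det (lift c)
    det[cM]≡det[c] = trans (det-⊗ (lift c) M) (trans (cong (det (lift c) *_) det≡1) (ℤ.*-identityʳ (det (lift c))))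

  ◃-cancel : ∀ {c M N} → Unimodular c → c ◃ M ≡ c ◃ N → M ≈ N
  ◃-cancel {c} {M} {N} c-unimodular eq = ⊗-cancelˡ {lift c} {M} {N} c-unimodular (begin
    lift c ⊗ M        ≈⟨ lift-reduce (lift c ⊗ M) ⟨
    lift (c ◃ M)      ≡⟨ cong lift eq ⟩
    lift (c ◃ N)      ≈⟨ lift-reduce (lift c ⊗ N) ⟩
    lift c ⊗ N        ∎)
    where open ≈-Reasoning ≈-setoid

module Counting where
  open import Data.Fin.Properties using (suc-injective; fromℕ<-injective; combine-injective; combine-remQuot; injective⇒≤)
  open import Data.Nat using (_≤_; _<_; _*_)

  record Enumeration {n} (P : Pred (Fin n) 0ℓ) : Set where
    field
      size              : ℕ
      element           : Fin size → Fin n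
      element-injective : ∀ {j j′} → element j ≡ element j′ → j ≡ j′
      sound             : ∀ j → P (element j)
      complete          : ∀ {x} → P x → ∃ λ j → element j ≡ x

  enumerate : ∀ {n} {P : Pred (Fin n) 0ℓ} → Decidable P → Enumeration P
  enumerate {zero} _ = record
    { size = 0 ; element = λ () ; element-injective = λ { {()} } ; sound = λ () ; complete = λ { {()} } }
  enumerate {suc n} {P} P? with enumerate {P = P ∘′ suc} (λ x → P? (suc x)) | P? zero
  ... | E | no ¬P0 = record
    { size = size ; element = suc ∘′ element
    ; element-injective = element-injective ∘′ suc-injective ; sound = sound ; complete = complete′ }
    where
    open Enumeration E
    complete′ : ∀ {x} → P x → ∃ λ j → suc (element j) ≡ x
    complete′ {zero}  P0 = contradiction P0 ¬P0
    complete′ {suc x} Px = proj₁ (complete Px) , cong suc (proj₂ (complete Px))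
  ... | E | yes P0 = record
    { size = suc size ; element = element′
    ; element-injective = injective′ ; sound = sound′ ; complete = complete′ }
    where
    open Enumeration E
    element′ : Fin (suc size) → Fin (suc n)
    element′ zero    = zero
    element′ (suc j) = suc (element j)
    injective′ : ∀ {j j′} → element′ j ≡ element′ j′ → j ≡ j′
    injective′ {zero}  {zero}   _  = refl
    injective′ {suc j} {suc j′} eq = cong suc (element-injective (suc-injective eq))
    injective′ {zero}  {suc _}  ()
    injective′ {suc _} {zero}   ()
    sound′ : ∀ j → P (element′ j)
    sound′ zero    = P0
    sound′ (suc j) = sound j
    complete′ : ∀ {x} → P x → ∃ λ j → element′ j ≡ x
    complete′ {zero}  _  = zero , refl
    complete′ {suc x} Px = suc (proj₁ (complete Px)) , cong suc (proj₂ (complete Px))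

  ×-injection⇒≤ : ∀ {n a b} {P : Pred (Fin n) 0ℓ} → Decidable P → ∃ P →
    (f : ∀ {x} → P x → Fin a → Fin n × Fin b) →
    (∀ {x} (p : P x) i → P (proj₁ (f p i))) →
    (∀ {x x′} (p : P x) (p′ : P x′) i i′ → f p i ≡ f p′ i′ → x ≡ x′ × i ≡ i′) →
    a ≤ b
  ×-injection⇒≤ {a = a} {b} P? (x₀ , P[x₀]) f f-sound f-injective =
    ℕ.*-cancelˡ-≤ size {{size≢0}} (injective⇒≤ {f = g} g-injective)
    where
    open Enumeration (enumerate P?)
    size≢0 : NonZero size
    size≢0 with size | proj₁ (complete P[x₀])
    ... | suc _ | _ = _
    index : ∀ u i → Fin size
    index u i = proj₁ (complete (f-sound (sound u) i))
    g : Fin (size * a) → Fin (size * b)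
    g j = let (u , i) = remQuot {size} a j in combine (index u i) (proj₂ (f (sound u) i))
    g-injective : ∀ {j j′} → g j ≡ g j′ → j ≡ j′
    g-injective {j} {j′} gj≡gj′ = begin
      j                                  ≡⟨ combine-remQuot {size} a j ⟨
      uncurry combine (remQuot {size} a j) ≡⟨ cong₂ (combine {size}) (element-injective (proj₁ same)) (proj₂ same) ⟩
      uncurry combine (remQuot {size} a j′) ≡⟨ combine-remQuot {size} a j′ ⟩
      j′                                 ∎
      where
      open ≡-Reasoning
      u = proj₁ (remQuot {size} a j)
      i = proj₂ (remQuot {size} a j)
      u′ = proj₁ (remQuot {size} a j′)
      i′ = proj₂ (remQuot {size} a j′)
      parts = combine-injective (index u i) (proj₂ (f (sound u) i)) (index u′ i′) (proj₂ (f (sound u′) i′)) gj≡gj′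
      same-target : proj₁ (f (sound u) i) ≡ proj₁ (f (sound u′) i′)
      same-target = trans (sym (proj₂ (complete (f-sound (sound u) i))))
                          (trans (cong element (proj₁ parts)) (proj₂ (complete (f-sound (sound u′) i′))))
      same = f-injective (sound u) (sound u′) i i′ (cong₂ _,_ same-target (proj₂ parts))

  module _ {n} {G : Graph n} (σ : Schedule G) where

    initiator : ∀ {τ x y} → Talk σ τ x y → Fin n
    initiator {x = x} (inj₁ _) = x
    initiator {y = y} (inj₂ _) = y

    -- A node initiates at most one call per round.
    initiator-injective : ∀ {τ x y x′ y′} (tk : Talk σ τ x y) (tk′ : Talk σ τ x′ y′) →
      initiator tk ≡ initiator tk′ → (x ≡ x′ × y ≡ y′) ⊎ (x ≡ y′ × y ≡ x′)
    initiator-injective {τ} (inj₁ c) (inj₁ c′) refl = inj₁ (refl , just-injective (trans (sym c) c′))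
    initiator-injective {τ} (inj₂ c) (inj₂ c′) refl = inj₁ (just-injective (trans (sym c) c′) , refl)
    initiator-injective {τ} (inj₁ c) (inj₂ c′) refl = inj₂ (refl , just-injective (trans (sym c) c′))
    initiator-injective {τ} (inj₂ c) (inj₁ c′) refl = inj₂ (just-injective (trans (sym c) c′) , refl)

    -- Charging each used edge to the initiator of its call and the round: t rounds serve at most t·|S| of the
    -- q·|S| distinct edges x — nb x i.
    rounds≥outdegree : ∀ {q t} {S : Pred (Fin n) 0ℓ} → Decidable S → ∃ S →
      (nb : ∀ {x} → S x → Fin q → Fin n) → (∀ {x} (p : S x) i → S (nb p i)) →
      (∀ {x x′} (p : S x) (p′ : S x′) i i′ →
         (x ≡ x′ × nb p i ≡ nb p′ i′) ⊎ (x ≡ nb p′ i′ × nb p i ≡ x′) → x ≡ x′ × i ≡ i′) →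
      (∀ {x} (p : S x) i → ∃ λ τ → τ < t × Talk σ τ x (nb p i)) →
      q ≤ t
    rounds≥outdegree {q} {t} {S} S? s nb nb-sound edges-distinct used =
      ×-injection⇒≤ S? s f f-sound f-injective
      where
      f : ∀ {x} → S x → Fin q → Fin n × Fin t
      f p i = let (τ , τ<t , tk) = used p i in initiator tk , fromℕ< τ<t
      f-sound : ∀ {x} (p : S x) i → S (proj₁ (f p i))
      f-sound p i with used p i
      ... | _ , _ , inj₁ _ = p
      ... | _ , _ , inj₂ _ = nb-sound p i
      f-injective : ∀ {x x′} (p : S x) (p′ : S x′) i i′ → f p i ≡ f p′ i′ → x ≡ x′ × i ≡ i′
      f-injective p p′ i i′ eq with used p i | used p′ i′
      ... | τ , τ<t , tk | τ′ , τ′<t , tk′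
        with fromℕ<-injective τ τ′ τ<t τ′<t (cong proj₂ eq)
      ... | refl = edges-distinct p p′ i i′ (initiator-injective tk tk′ (cong proj₁ eq))

module CayleyGraph (n m q : ℕ) .{{_ : NonZero m}}
                   (fits : m ℕ.^ 4 ℕ.≤ n) (separates : suc ((2 ℕ.* EntryBounds.entryBound q) ℕ.^ q) ℕ.< m) where
  open import Data.Fin.Properties using (toℕ<n; inject≤-injective; any?)
  open import Data.Integer using (1ℤ)
  open import Data.Nat using (_≤_; _<_; _^_)
  open import Data.Vec.Recursive using (Fin[m^n]↔Fin[m]^n)
  open import Function.Bundles using (Inverse; _↔_)
  import Relation.Nullary.Decidable as Dec
  open import Relation.Nullary.Decidable using (_×-dec_)
  import Relation.Binary.Reasoning.Setoid as ≈-Reasoning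

  open Matrices
  open PingPong
  open FreeReduction
  open EntryBounds
  open Congruences m
  open Counting

  noShortRelation : ∀ {w : Word q} → Reduced w → length w ≤ q → val w ≈ 𝕀 → w ≡ []
  noShortRelation {[]}    _   _     _      = refl
  noShortRelation {l ∷ w} red short val≈𝕀 =
    contradiction (≈𝕀⇒≡𝕀 (∥val∥≤ (l ∷ w)) (ℕ.≤-<-trans (s≤s entries-small) separates) val≈𝕀) (val≢𝕀 red)
    where
    2G≢0 : NonZero (2 ℕ.* entryBound q)
    2G≢0 = ℕ.>-nonZero (ℕ.≤-trans (s≤s z≤n)
             (ℕ.*-monoʳ-≤ 2 (ℕ.≤-trans (s≤s z≤n) (ℕ.m≤n+m 2 (16 ℕ.* (q ℕ.* q))))))
    entries-small : (2 ℕ.* entryBound q) ^ length (l ∷ w) ≤ (2 ℕ.* entryBound q) ^ q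
    entries-small = ℕ.^-monoʳ-≤ (2 ℕ.* entryBound q) {{2G≢0}} short

  gen≉𝕀 : ∀ l → ¬ gen l ≈ 𝕀
  gen≉𝕀 l@(i , _) gen≈𝕀 = case noShortRelation {l ∷ []} [-] (ℕ.≤-trans (s≤s z≤n) (toℕ<n i))
                                  (≈-trans (≈-reflexive (⊗-identityˡ (gen l))) gen≈𝕀) of λ ()

  gen⊗gen≉𝕀 : 2 ≤ q → ∀ {l l′} → l ≢ l′ ⁻¹ → ¬ gen l′ ⊗ gen l ≈ 𝕀
  gen⊗gen≉𝕀 2≤q {l} {l′} l≢l′⁻¹ product≈𝕀 = case noShortRelation {l ∷ l′ ∷ []} (l≢l′⁻¹ ∷ [-]) 2≤q
    (≈-trans (≈-reflexive (cong (_⊗ gen l) (⊗-identityˡ (gen l′)))) product≈𝕀) of λ ()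

  det-gen : ∀ (l : Letter q) → det (gen l) ≡ 1ℤ
  det-gen (i , s) = det-generator (ι i) (sign s)

  matrices↔ : Fin (m ^ 4) ↔ MatMod
  matrices↔ = Fin[m^n]↔Fin[m]^n m 4

  embed : MatMod → Fin n
  embed c = inject≤ (Inverse.from matrices↔ c) fits

  embed-injective : ∀ {c c′} → embed c ≡ embed c′ → c ≡ c′
  embed-injective {c} {c′} eq = begin
    c                                   ≡⟨ Inverse.strictlyInverseˡ matrices↔ c ⟨
    to (from c)                         ≡⟨ cong to (inject≤-injective fits fits (from c) (from c′) eq) ⟩
    to (from c′)                        ≡⟨ Inverse.strictlyInverseˡ matrices↔ c′ ⟩
    c′                                  ∎
    where
    open ≡-Reasoning
    open Inverse matrices↔ using (to; from)

  ◃-gen-⁻¹ : ∀ c (l : Letter q) → c ◃ gen l ◃ gen (l ⁻¹) ≡ c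
  ◃-gen-⁻¹ c l = trans (◃-⊗ c (gen l) (gen (l ⁻¹))) (trans (cong (c ◃_) (gen-⁻¹ l)) (◃-𝕀 c))

  record Edge (x y : Fin n) : Set where
    constructor edge
    field
      {source}   : MatMod
      letter     : Letter q
      unimodular : Unimodular source
      tail≡      : embed source ≡ x
      head≡      : embed (source ◃ gen letter) ≡ y

  edge-sym : ∀ {x y} → Edge x y → Edge y x
  edge-sym (edge {source = c} l c-unimodular tail≡ head≡) =
    edge {source = c ◃ gen l} (l ⁻¹) (◃-unimodular {c} {gen l} (det-gen l) c-unimodular)
         head≡ (trans (cong embed (◃-gen-⁻¹ c l)) tail≡)

  edge-irrefl : ∀ {x} → ¬ Edge x x
  edge-irrefl (edge {source = c} l c-unimodular tail≡ head≡) =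
    gen≉𝕀 l (≈-sym (◃-cancel {c} {𝕀} {gen l} c-unimodular loop))
    where
    loop : c ◃ 𝕀 ≡ c ◃ gen l
    loop = trans (◃-𝕀 c) (embed-injective (trans tail≡ (sym head≡)))

  cayley : Graph n
  cayley = record { Adj = Edge ; sym = edge-sym ; irrefl = edge-irrefl }

  ◃-gen-injective : 2 ≤ q → ∀ {c i i′} → Unimodular c → c ◃ gen (i , true) ≡ c ◃ gen (i′ , true) → i ≡ i′
  ◃-gen-injective 2≤q {c} {i} {i′} c-unimodular eq with i ≟ i′
  ... | yes i≡i′ = i≡i′
  ... | no  i≢i′ = contradiction relation (gen⊗gen≉𝕀 2≤q (i≢i′ ∘ sym ∘ cong proj₁))
    where
    open ≈-Reasoning ≈-setoid
    relation : gen (i , true) ⊗ gen (i′ , false) ≈ 𝕀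
    relation = begin
      gen (i , true) ⊗ gen (i′ , false)
        ≈⟨ ⊗-cong (◃-cancel {c} {gen (i , true)} {gen (i′ , true)} c-unimodular eq) (≈-refl {gen (i′ , false)}) ⟩
      gen (i′ , true) ⊗ gen (i′ , false)  ≡⟨ gen-⁻¹ (i′ , true) ⟩
      𝕀                                   ∎

  ◃-gen-◃-gen≢ : 2 ≤ q → ∀ {c i i′} → Unimodular c → c ◃ gen (i , true) ◃ gen (i′ , true) ≢ c
  ◃-gen-◃-gen≢ 2≤q {c} {i} {i′} c-unimodular eq =
    gen⊗gen≉𝕀 2≤q (λ ()) (≈-sym (◃-cancel {c} {𝕀} {gen (i , true) ⊗ gen (i′ , true)} c-unimodular cycle))
    where
    cycle : c ◃ 𝕀 ≡ c ◃ (gen (i , true) ⊗ gen (i′ , true))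
    cycle = trans (◃-𝕀 c) (trans (sym eq) (◃-⊗ c (gen (i , true)) (gen (i′ , true))))

  SL₂ : Pred (Fin n) 0ℓ
  SL₂ x = ∃ λ c → Unimodular c × embed c ≡ x

  SL₂? : Decidable SL₂
  SL₂? x = Dec.map′ fromIndex toIndex (any? (λ y → unimodular? (to y) ×-dec (inject≤ y fits ≟ x)))
    where
    open Inverse matrices↔ using (to; from; strictlyInverseˡ; strictlyInverseʳ)
    fromIndex : ∃ (λ y → Unimodular (to y) × inject≤ y fits ≡ x) → SL₂ x
    fromIndex (y , unimodular , eq) = to y , unimodular , trans (cong (λ z → inject≤ z fits) (strictlyInverseʳ y)) eq
    toIndex : SL₂ x → ∃ (λ y → Unimodular (to y) × inject≤ y fits ≡ x)
    toIndex (c , unimodular , eq) = from c , subst Unimodular (sym (strictlyInverseˡ c)) unimodular , eq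

  identity-SL₂ : ∃ SL₂
  identity-SL₂ = embed (reduce 𝕀) , reduce 𝕀 , det-cong {lift (reduce 𝕀)} {𝕀} (lift-reduce 𝕀) , refl

  neighbour : ∀ {x} → SL₂ x → Fin q → Fin n
  neighbour (c , _) i = embed (c ◃ gen (i , true))

  neighbour-SL₂ : ∀ {x} (p : SL₂ x) i → SL₂ (neighbour p i)
  neighbour-SL₂ (c , c-unimodular , _) i =
    c ◃ gen (i , true) , ◃-unimodular {c} {gen (i , true)} (det-gen (i , true)) c-unimodular , refl

  neighbour-edges-distinct : 2 ≤ q → ∀ {x x′} (p : SL₂ x) (p′ : SL₂ x′) i i′ →
    (x ≡ x′ × neighbour p i ≡ neighbour p′ i′) ⊎ (x ≡ neighbour p′ i′ × neighbour p i ≡ x′) →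
    x ≡ x′ × i ≡ i′
  neighbour-edges-distinct 2≤q (c , c-unimodular , c≡x) (c′ , _ , c′≡x′) i i′ (inj₁ (x≡x′ , same-neighbour)) =
    x≡x′ , ◃-gen-injective 2≤q {c} {i} {i′} c-unimodular (embed-injective (trans same-neighbour (sym c′-neighbour)))
    where
    c′-neighbour : embed (c ◃ gen (i′ , true)) ≡ embed (c′ ◃ gen (i′ , true))
    c′-neighbour = cong (λ d → embed (d ◃ gen (i′ , true)))
                        (embed-injective (trans c≡x (trans x≡x′ (sym c′≡x′))))
  neighbour-edges-distinct 2≤q (c , c-unimodular , c≡x) (c′ , _ , c′≡x′) i i′ (inj₂ (x≡nb′ , nb≡x′)) =
    contradiction (embed-injective (trans (cong (λ d → embed (d ◃ gen (i′ , true))) c′≡)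
                                          (sym (trans c≡x x≡nb′))))
                  (◃-gen-◃-gen≢ 2≤q {c} {i} {i′} c-unimodular)
    where
    c′≡ : c ◃ gen (i , true) ≡ c′
    c′≡ = embed-injective (trans nb≡x′ (sym c′≡x′))

  module _ (σ : Schedule cayley) where

    talk⇒edge : ∀ {τ v w} → Talk σ τ v w → Edge w v
    talk⇒edge {τ} {v} {w} (inj₁ call≡) = edge-sym (valid σ τ v w call≡)
    talk⇒edge {τ} {v} {w} (inj₂ call≡) = valid σ τ w v call≡

    EarlyTalk : ℕ → Fin n → Fin n → Set
    EarlyTalk t x y = ∃ λ τ → τ < t × Talk σ τ x y

    later : ∀ {t x y} → EarlyTalk t x y → EarlyTalk (suc t) x y
    later (τ , τ<t , tk) = τ , ℕ.m≤n⇒m≤1+n τ<t , tk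

    -- The freely reduced word of a walk from u = embed c along which w learnt u's message; the first letter
    -- of the walk (the last element of the list) names an edge at u along which a call took place.
    record Trace (t : ℕ) (u w : Fin n) (c : MatMod) : Set where
      field
        word    : Word q
        reduced : Reduced word
        short   : length word ≤ t
        ends    : embed (c ◃ val word) ≡ w
        starts  : ∀ {l} → last word ≡ just l → EarlyTalk t u (embed (c ◃ gen l))

    trace : ∀ {t u w c} → embed c ≡ u → Knows σ t w u → Trace t u w c
    trace {c = c} c≡u self = record
      { word = [] ; reduced = [] ; short = z≤n ; ends = trans (cong embed (◃-𝕀 c)) c≡u ; starts = λ () }
    trace c≡u (keep known) = record
      { word = word ; reduced = reduced ; short = ℕ.m≤n⇒m≤1+n short ; ends = ends ; starts = later ∘ starts }
      where open Trace (trace c≡u known)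
    trace {suc t} {u} {v} {c} c≡u (recv {w = w} tk known) = record
      { word = push word l ; reduced = push-reduced l reduced
      ; short = ℕ.≤-trans (length-push word l) (s≤s short) ; ends = ends′ ; starts = starts′ }
      where
      open Trace (trace c≡u known)
      open Edge (talk⇒edge tk) renaming (letter to l)
      source≡ : source ≡ c ◃ val word
      source≡ = embed-injective (trans tail≡ (sym ends))
      ends′ : embed (c ◃ val (push word l)) ≡ v
      ends′ = begin
        embed (c ◃ val (push word l))    ≡⟨ cong (λ M → embed (c ◃ M)) (val-push word l) ⟩
        embed (c ◃ (val word ⊗ gen l))   ≡⟨ cong embed (◃-⊗ c (val word) (gen l)) ⟨
        embed (c ◃ val word ◃ gen l)     ≡⟨ cong (λ s → embed (s ◃ gen l)) source≡ ⟨
        embed (source ◃ gen l)           ≡⟨ head≡ ⟩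
        v                                ∎
        where open ≡-Reasoning
      first-step : word ≡ [] → ∀ {l₀} → l ≡ l₀ → EarlyTalk (suc t) u (embed (c ◃ gen l₀))
      first-step word≡[] l≡l₀ = t , ℕ.≤-refl , subst₂ (Talk σ t) w≡u v≡ (swap tk)
        where
        source≡c : source ≡ c
        source≡c = trans source≡ (trans (cong (λ r → c ◃ val r) word≡[]) (◃-𝕀 c))
        w≡u = trans (sym tail≡) (trans (cong embed source≡c) c≡u)
        v≡ = trans (sym head≡) (cong₂ (λ s l → embed (s ◃ gen l)) source≡c l≡l₀)
      starts′ : ∀ {l₀} → last (push word l) ≡ just l₀ → EarlyTalk (suc t) u (embed (c ◃ gen l₀))
      starts′ eq with last-push word l eq
      ... | inj₁ (word≡[] , l≡l₀) = first-step word≡[] l≡l₀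
      ... | inj₂ eq′               = later (starts eq′)

    -- Within fewer than q rounds no other walk can replace an edge, so every edge is used.
    edge-used : ∀ {t u v} → SolvesNE σ t → suc t ≤ q → Edge u v → EarlyTalk t u v
    edge-used {t} {u} {v} solves t<q e@(edge {source = c} g c-unimodular c≡u head≡) =
      subst (EarlyTalk t u) head≡ (starts (cong last word≡[g]))
      where
      open Trace (trace c≡u (solves v u (edge-sym e)))
      val≈gen : val word ≈ gen g
      val≈gen = ◃-cancel {c} {val word} {gen g} c-unimodular (embed-injective (trans ends (sym head≡)))
      cancelled : val (push word (g ⁻¹)) ≈ 𝕀
      cancelled = begin
        val (push word (g ⁻¹))    ≡⟨ val-push word (g ⁻¹) ⟩
        val word ⊗ gen (g ⁻¹)     ≈⟨ ⊗-cong val≈gen (≈-refl {gen (g ⁻¹)}) ⟩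
        gen g ⊗ gen (g ⁻¹)        ≡⟨ gen-⁻¹ g ⟩
        𝕀                         ∎
        where open ≈-Reasoning ≈-setoid
      word≡[g] : word ≡ g ∷ []
      word≡[g] = push-⁻¹≡[] word g (noShortRelation (push-reduced (g ⁻¹) reduced)
                   (ℕ.≤-trans (length-push word (g ⁻¹)) (ℕ.≤-trans (s≤s short) t<q)) cancelled)

    lowerBound : 2 ≤ q → ∀ t → SolvesNE σ t → q ≤ t
    lowerBound 2≤q t solves with q ℕ.≤? t
    ... | yes q≤t = q≤t
    ... | no  q≰t = rounds≥outdegree σ SL₂? identity-SL₂ neighbour neighbour-SL₂ (neighbour-edges-distinct 2≤q)
      λ (c , c-unimodular , c≡x) i → edge-used solves (ℕ.≰⇒> q≰t) (edge (i , true) c-unimodular c≡x refl)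

open import Data.Nat using (_≤_; _*_; _^_)
open import Data.Nat.Properties using (m^n≢0)
open import Data.Nat.Logarithm using (⌊log₂_⌋)
open Arithmetic using (Parameters; parameters)

corollary4 : Σ ℕ λ c → Σ ℕ λ n₀ → ∀ (A : Algorithm) (n : ℕ) → n₀ ≤ n →
    Σ (Graph n) λ G → ∀ (t : ℕ) → SolvesNE (A n G) t →
      ⌊log₂ n ⌋ ≤ c * (t * ⌊log₂ ⌊log₂ n ⌋ ⌋)
corollary4 = 25 , 2 ^ 256 , λ A n n≥2^256 →
  let open Parameters (parameters n n≥2^256)
      open CayleyGraph n (2 ^ k) q {{m^n≢0 2 k}} fits separates
  in cayley , λ t solves → rounds⇒log (lowerBound (A n cayley) 2≤q t solves)
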